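{- There exist two infinite sets $A$ and $M$ of positive integers such that $p(n,A,M)=1$ for every positive integer $n$.
   Context: For sets $A$, $M$ of positive integers and a positive integer $n$, $p(n,A,M)$ denotes the number of representations of $n$ in the form $n=\sum_{a\in A} m_a a$, where $m_a\in M\cup\{0\}$ for every $a\in A$ and all but finitely many $m_a$ equal $0$ (two representations are different if their coefficient families $(m_a)_{a\in A}$ differ). -}

module Defs where

open import Data.Nat using (ℕ; zero; suc; _+_; _*_; _≤_; _<_)
open import Data.Product using (Σ; ∃; _×_; _,_)
open import Data.Sum using (_⊎_)
open import Relation.Binary.PropositionalEquality using (_≡_; _≢_)

NSet : Set₁
NSet = ℕ → Set

Positive : NSet → Set
Positive S = ∀ a → S a → 1 ≤ a

Infinite : NSet → Set
Infinite S = ∀ k → Σ ℕ λ a → k ≤ a × S a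

sumBelow : ℕ → (ℕ → ℕ) → ℕ
sumBelow zero    f = 0
sumBelow (suc B) f = sumBelow B f + f B

-- A representation of n as Σ_{a∈A} m_a a with m_a ∈ M ∪ {0}, almost all 0.
-- The family (m_a)_{a∈A} is encoded as a function ℕ → ℕ that vanishes
-- outside A (extension by zero); `bound` witnesses finite support.
record Representation (n : ℕ) (A M : NSet) : Set where
  field
    coeff      : ℕ → ℕ
    coeff-ok   : ∀ a → coeff a ≢ 0 → A a × M (coeff a)
    bound      : ℕ
    support    : ∀ a → bound ≤ a → coeff a ≡ 0
    sums-to    : sumBelow bound (λ a → coeff a * a) ≡ n

open Representation public

-- p(n, A, M) = 1 : there is a representation, and any two representations
-- have the same coefficient family.
HasUniqueRepresentation : ℕ → NSet → NSet → Set
HasUniqueRepresentation n A M =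
  Σ (Representation n A M) λ r →
    ∀ (r' : Representation n A M) → ∀ a → coeff r' a ≡ coeff r a

-- Classify binary digit positions by parity and let E (resp. F) be the
-- numbers all of whose binary digits sit at even (resp. odd) positions.
-- Every t splits uniquely as t = e + f with e ∈ E, f ∈ F: e keeps the digits
-- of t at even positions, f those at odd positions.  Put
--     A = { 2^e : e ∈ E },     M = { m ≥ 1 : every binary digit of m sits at a position in F }.
-- If m ∈ M ∪ {0} and e ∈ E, the digits of m·2^e sit at positions e + f with
-- f ∈ F, and by unique splitting these position sets are disjoint for
-- different e.  Hence for any representation n = Σ m_a a, digit t of n equals
-- digit (oddPart t) of the coefficient of 2^(evenPart t): this "digit formula"
-- determines every coefficient (uniqueness) and shows that the coefficients
-- read off from the digits of n form a representation (existence).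
module Submission where

open import Defs
open import Data.Nat
open import Data.Nat.Properties
open import Data.Nat.DivMod
open import Data.Nat.Logarithm using (⌊log₂_⌋; ⌊log₂[2^n]⌋≡n)
open import Data.Parity.Base using (0ℙ; 1ℙ) renaming (_+_ to _+ℙ_)
import Data.Parity.Properties as Parity
open import Data.Product
open import Data.Sum using (_⊎_; inj₁; inj₂)
open import Data.Empty using (⊥-elim)
open import Function using (_∘_)
open import Level using (0ℓ)
open import Relation.Nullary using (¬_; yes; no)
open import Relation.Nullary.Negation using (contradiction; negated-stable)
open import Relation.Nullary.Decidable using (map′)
open import Relation.Unary using (Pred; Decidable; ∁)
open import Relation.Unary.Properties using (∁?)
open import Relation.Binary.PropositionalEquality

-- Binary digits

bit : ℕ → ℕ → ℕ
bit x zero    = x % 2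
bit x (suc t) = bit (x / 2) t

bit≤1 : ∀ x t → bit x t ≤ 1
bit≤1 x zero    = m<1+n⇒m≤n (m%n<n x 2)
bit≤1 x (suc t) = bit≤1 (x / 2) t

bit-zero : ∀ t → bit 0 t ≡ 0
bit-zero zero    = refl
bit-zero (suc t) = bit-zero t

n<2^n : ∀ n → n < 2 ^ n
n<2^n zero    = s≤s z≤n
n<2^n (suc n) = begin-strict
  suc n          ≤⟨ n<2^n n ⟩
  2 ^ n          ≡⟨ +-identityʳ (2 ^ n) ⟨
  2 ^ n + 0      <⟨ +-monoʳ-< (2 ^ n) (m^n>0 2 n) ⟩
  2 ^ n + 2 ^ n  ≡⟨ cong (2 ^ n +_) (sym (+-identityʳ (2 ^ n))) ⟩
  2 ^ suc n      ∎
  where open ≤-Reasoning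

halve-below : ∀ {x} k → x < 2 ^ suc k → x / 2 < 2 ^ k
halve-below {x} k x<2^k+1 = m<n*o⇒m/o<n (subst (x <_) (*-comm 2 (2 ^ k)) x<2^k+1)

bit-small : ∀ t {x} → x < 2 ^ t → bit x t ≡ 0
bit-small zero    (s≤s z≤n) = refl
bit-small (suc t) x<2^t+1   = bit-small t (halve-below t x<2^t+1)

bit-cons : ∀ {a} y → a ≤ 1 → (a + 2 * y) % 2 ≡ a × (a + 2 * y) / 2 ≡ y
bit-cons {a} y a≤1 = low , high
  where
    a<2 : a < 2
    a<2 = s≤s a≤1
    a+2y≡a+y*2 : a + 2 * y ≡ a + y * 2
    a+2y≡a+y*2 = cong (a +_) (*-comm 2 y)
    low : (a + 2 * y) % 2 ≡ a
    low = begin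
      (a + 2 * y) % 2 ≡⟨ cong (_% 2) a+2y≡a+y*2 ⟩
      (a + y * 2) % 2 ≡⟨ [m+kn]%n≡m%n a y 2 ⟩
      a % 2           ≡⟨ m<n⇒m%n≡m a<2 ⟩
      a               ∎
      where open ≡-Reasoning
    high : (a + 2 * y) / 2 ≡ y
    high = begin
      (a + 2 * y) / 2   ≡⟨ cong (_/ 2) a+2y≡a+y*2 ⟩
      (a + y * 2) / 2   ≡⟨ +-distrib-/ a (y * 2) digits-fit ⟩
      a / 2 + y * 2 / 2 ≡⟨ cong₂ _+_ (m<n⇒m/n≡0 a<2) (m*n/n≡m y 2) ⟩
      y                 ∎
      where
        open ≡-Reasoning
        digits-fit : a % 2 + y * 2 % 2 < 2
        digits-fit = subst (_< 2) (sym (trans (cong₂ _+_ (m<n⇒m%n≡m a<2) (m*n%n≡0 y 2)) (+-identityʳ a))) a<2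

-- Numbers with the same digits are equal (x, y < 2^k bounds the recursion).
bit-ext-below : ∀ k {x y} → x < 2 ^ k → y < 2 ^ k → (∀ t → bit x t ≡ bit y t) → x ≡ y
bit-ext-below zero    (s≤s z≤n) (s≤s z≤n) same = refl
bit-ext-below (suc k) {x} {y} x< y< same = begin
  x                   ≡⟨ m≡m%n+[m/n]*n x 2 ⟩
  x % 2 + x / 2 * 2   ≡⟨ cong₂ (λ u v → u + v * 2) (same 0) halves-equal ⟩
  y % 2 + y / 2 * 2   ≡⟨ sym (m≡m%n+[m/n]*n y 2) ⟩
  y                   ∎
  where
    open ≡-Reasoning
    halves-equal : x / 2 ≡ y / 2
    halves-equal = bit-ext-below k (halve-below k x<) (halve-below k y<) (same ∘ suc)

bit-ext : ∀ {x y} → (∀ t → bit x t ≡ bit y t) → x ≡ y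
bit-ext {x} {y} = bit-ext-below (x + y)
  (<-≤-trans (n<2^n x) (^-monoʳ-≤ 2 (m≤m+n x y)))
  (<-≤-trans (n<2^n y) (^-monoʳ-≤ 2 (m≤n+m y x)))

DigitDisjoint : ℕ → ℕ → Set
DigitDisjoint x y = ∀ s → bit x s ≡ 0 ⊎ bit y s ≡ 0

no-carry : ∀ {x y} → DigitDisjoint x y → x % 2 + y % 2 ≤ 1
no-carry {x} {y} disj with disj 0
... | inj₁ x0 rewrite x0 = bit≤1 y 0
... | inj₂ y0 rewrite y0 | +-identityʳ (x % 2) = bit≤1 x 0

bit-+ : ∀ {x y} → DigitDisjoint x y → ∀ t → bit (x + y) t ≡ bit x t + bit y t
bit-+ {x} {y} disj zero    = trans (%-distribˡ-+ x y 2) (m<n⇒m%n≡m (s≤s (no-carry disj)))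
bit-+ {x} {y} disj (suc t) = begin
  bit ((x + y) / 2) t           ≡⟨ cong (λ z → bit z t) (+-distrib-/ x y (s≤s (no-carry disj))) ⟩
  bit (x / 2 + y / 2) t         ≡⟨ bit-+ (disj ∘ suc) t ⟩
  bit (x / 2) t + bit (y / 2) t ∎
  where open ≡-Reasoning

-- Multiplying by 2^(p+1) is doubling x · 2^p, in the form read off by bit-cons.
double-shift : ∀ x p → x * 2 ^ suc p ≡ 0 + 2 * (x * 2 ^ p)
double-shift x p = trans (sym (*-assoc x 2 (2 ^ p)))
  (trans (cong (_* 2 ^ p) (*-comm x 2)) (*-assoc 2 x (2 ^ p)))

bit-shift-high : ∀ p x s → bit (x * 2 ^ p) (p + s) ≡ bit x s
bit-shift-high zero    x s rewrite *-identityʳ x = refl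
bit-shift-high (suc p) x s rewrite double-shift x p | proj₂ (bit-cons {0} (x * 2 ^ p) z≤n) =
  bit-shift-high p x s

bit-shift-low : ∀ p x {t} → t < p → bit (x * 2 ^ p) t ≡ 0
bit-shift-low (suc p) x {zero}  _ rewrite double-shift x p = proj₁ (bit-cons {0} (x * 2 ^ p) z≤n)
bit-shift-low (suc p) x {suc t} (s≤s t<p) rewrite double-shift x p | proj₂ (bit-cons {0} (x * 2 ^ p) z≤n) =
  bit-shift-low p x t<p

bit-2^ : ∀ p {s} → s ≢ p → bit (2 ^ p) s ≡ 0
bit-2^ zero    {zero}  s≢p = ⊥-elim (s≢p refl)
bit-2^ zero    {suc s} _   = bit-zero s
bit-2^ (suc p) {zero}  _   = proj₁ (bit-cons {0} (2 ^ p) z≤n)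
bit-2^ (suc p) {suc s} s≢p rewrite proj₂ (bit-cons {0} (2 ^ p) z≤n) = bit-2^ p (s≢p ∘ cong suc)

shiftDown : ℕ → ℕ → ℕ
shiftDown x zero    = x
shiftDown x (suc e) = shiftDown (x / 2) e

bit-shiftDown : ∀ e x f → bit (shiftDown x e) f ≡ bit x (e + f)
bit-shiftDown zero    x f = refl
bit-shiftDown (suc e) x f = bit-shiftDown e (x / 2) f

shiftDown-small : ∀ e {x} → x < 2 ^ e → shiftDown x e ≡ 0
shiftDown-small zero    (s≤s z≤n) = refl
shiftDown-small (suc e) x<2^e+1   = shiftDown-small e (halve-below e x<2^e+1)

fromDigits : ℕ → (ℕ → ℕ) → ℕ
fromDigits zero    g = 0
fromDigits (suc K) g = g 0 + 2 * fromDigits K (g ∘ suc)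

bit-fromDigits : ∀ K g → (∀ s → g s ≤ 1) → (∀ s → K ≤ s → g s ≡ 0) →
                 ∀ s → bit (fromDigits K g) s ≡ g s
bit-fromDigits zero    g _    vanish s       = trans (bit-zero s) (sym (vanish s z≤n))
bit-fromDigits (suc K) g g≤1 vanish zero    = proj₁ (bit-cons (fromDigits K (g ∘ suc)) (g≤1 0))
bit-fromDigits (suc K) g g≤1 vanish (suc s)
  rewrite proj₂ (bit-cons (fromDigits K (g ∘ suc)) (g≤1 0)) =
  bit-fromDigits K (g ∘ suc) (g≤1 ∘ suc) (λ s K≤s → vanish (suc s) (s≤s K≤s)) s

-- Filtering the digits of a number to a decidable set of positions

DigitsIn : Pred ℕ 0ℓ → ℕ → Set
DigitsIn P x = ∀ s → ¬ P s → bit x s ≡ 0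

module _ {P : Pred ℕ 0ℓ} (P? : Decidable P) where

  keptDigit : ℕ → ℕ → ℕ
  keptDigit x s with P? s
  ... | yes _ = bit x s
  ... | no _  = 0

  keep : ℕ → ℕ
  keep x = fromDigits x (keptDigit x)

  -- keep x has digits keptDigit x (its digits vanish beyond x since x < 2^x).
  bit-keep : ∀ x s → bit (keep x) s ≡ keptDigit x s
  bit-keep x = bit-fromDigits x (keptDigit x) kept≤1 vanish
    where
      kept≤1 : ∀ s → keptDigit x s ≤ 1
      kept≤1 s with P? s
      ... | yes _ = bit≤1 x s
      ... | no _  = z≤n
      vanish : ∀ s → x ≤ s → keptDigit x s ≡ 0
      vanish s x≤s with P? s
      ... | yes _ = bit-small s (≤-<-trans x≤s (n<2^n s))
      ... | no _  = refl

  bit-keep-in : ∀ x {s} → P s → bit (keep x) s ≡ bit x s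
  bit-keep-in x {s} p with P? s | bit-keep x s
  ... | yes _ | eq = eq
  ... | no ¬p | _  = ⊥-elim (¬p p)

  bit-keep-out : ∀ x {s} → ¬ P s → bit (keep x) s ≡ 0
  bit-keep-out x {s} ¬p with P? s | bit-keep x s
  ... | yes p | _  = ⊥-elim (¬p p)
  ... | no _  | eq = eq

  keep-DigitsIn : ∀ x → DigitsIn P (keep x)
  keep-DigitsIn x s = bit-keep-out x

  keep-id : ∀ {x} → DigitsIn P x → keep x ≡ x
  keep-id {x} inP = bit-ext digit
    where
      digit : ∀ s → bit (keep x) s ≡ bit x s
      digit s with P? s
      ... | yes p = bit-keep-in x p
      ... | no ¬p = trans (bit-keep-out x ¬p) (sym (inP s ¬p))

  DigitsIn? : Decidable (DigitsIn P)
  DigitsIn? x = map′ (λ eq → subst (DigitsIn P) eq (keep-DigitsIn x)) keep-id (keep x ≟ x)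

  keep-+ : ∀ {x y} → DigitsIn P x → DigitsIn (∁ P) y → keep (x + y) ≡ x
  keep-+ {x} {y} inP offP = bit-ext digit
    where
      disjoint : DigitDisjoint x y
      disjoint s with P? s
      ... | yes p = inj₂ (offP s (contradiction p))
      ... | no ¬p = inj₁ (inP s ¬p)
      digit : ∀ s → bit (keep (x + y)) s ≡ bit x s
      digit s with P? s
      ... | yes p = begin
        bit (keep (x + y)) s ≡⟨ bit-keep-in (x + y) p ⟩
        bit (x + y) s        ≡⟨ bit-+ disjoint s ⟩
        bit x s + bit y s    ≡⟨ cong (bit x s +_) (offP s (contradiction p)) ⟩
        bit x s + 0          ≡⟨ +-identityʳ (bit x s) ⟩
        bit x s              ∎
        where open ≡-Reasoning
      ... | no ¬p = trans (bit-keep-out (x + y) ¬p) (sym (inP s ¬p))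

keep-split : ∀ {P : Pred ℕ 0ℓ} (P? : Decidable P) x → keep P? x + keep (∁? P?) x ≡ x
keep-split {P} P? x = bit-ext digit
  where
    disjoint : DigitDisjoint (keep P? x) (keep (∁? P?) x)
    disjoint u with P? u
    ... | yes p = inj₂ (bit-keep-out (∁? P?) x (contradiction p))
    ... | no ¬p = inj₁ (bit-keep-out P? x ¬p)
    digit : ∀ s → bit (keep P? x + keep (∁? P?) x) s ≡ bit x s
    digit s with P? s
    ... | yes p rewrite bit-+ disjoint s | bit-keep-in P? x p
                      | bit-keep-out (∁? P?) x (contradiction p) = +-identityʳ (bit x s)
    ... | no ¬p rewrite bit-+ disjoint s | bit-keep-out P? x ¬p = bit-keep-in (∁? P?) x ¬p

-- Splitting digit positions by parity

EvenPos : Pred ℕ 0ℓ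
EvenPos s = parity s ≡ 0ℙ

evenPos? : Decidable EvenPos
evenPos? s = parity s Parity.≟ 0ℙ

EvenDigits OddDigits : Pred ℕ 0ℓ
EvenDigits = DigitsIn EvenPos
OddDigits  = DigitsIn (∁ EvenPos)

oddDigits? : Decidable OddDigits
oddDigits? = DigitsIn? (∁? evenPos?)

evenPart oddPart : ℕ → ℕ
evenPart = keep evenPos?
oddPart  = keep (∁? evenPos?)

evenPart-digits : ∀ t → EvenDigits (evenPart t)
evenPart-digits = keep-DigitsIn evenPos?

oddPart-digits : ∀ t → OddDigits (oddPart t)
oddPart-digits = keep-DigitsIn (∁? evenPos?)

evenPart+oddPart : ∀ t → evenPart t + oddPart t ≡ t
evenPart+oddPart = keep-split evenPos?

split-unique : ∀ {e f} → EvenDigits e → OddDigits f → evenPart (e + f) ≡ e × oddPart (e + f) ≡ f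
split-unique {e} {f} Ee Ff = evenPart-eq , oddPart-eq
  where
    evenPart-eq : evenPart (e + f) ≡ e
    evenPart-eq = keep-+ evenPos? Ee Ff
    oddPart-eq : oddPart (e + f) ≡ f
    oddPart-eq = trans (cong oddPart (+-comm e f))
      (keep-+ (∁? evenPos?) Ff (λ s → Ee s ∘ negated-stable))

-- The sets A and M, and the digits of a sum Σ c_a a

A M : NSet
A a = Σ ℕ λ e → EvenDigits e × a ≡ 2 ^ e
M m = 1 ≤ m × DigitsIn OddDigits m

Admissible : (ℕ → ℕ) → Set
Admissible c = ∀ a → c a ≢ 0 → A a × M (c a)

termSum : (ℕ → ℕ) → ℕ → ℕ
termSum c B = sumBelow B (λ a → c a * a)

coeff-digits : ∀ {c} → Admissible c → ∀ a → DigitsIn OddDigits (c a)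
coeff-digits {c} adm a with c a ≟ 0
... | yes ca≡0 rewrite ca≡0 = λ s _ → bit-zero s
... | no ca≢0  = proj₂ (proj₂ (adm a ca≢0))

shifted-digit-off : ∀ {x e} t → DigitsIn OddDigits x → EvenDigits e → evenPart t ≢ e →
                    bit (x * 2 ^ e) t ≡ 0
shifted-digit-off {x} {e} t xF Ee ne with t <? e
... | yes t<e = bit-shift-low e x t<e
... | no t≮e with m≤n⇒∃[o]m+o≡n (≮⇒≥ t≮e)
...   | s , refl = trans (bit-shift-high e x s) (xF s (λ Fs → ne (proj₁ (split-unique Ee Fs))))

shifted-digit-on : ∀ x t → bit (x * 2 ^ evenPart t) t ≡ bit x (oddPart t)
shifted-digit-on x t =
  subst (λ u → bit (x * 2 ^ evenPart t) u ≡ bit x (oddPart t))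
        (evenPart+oddPart t) (bit-shift-high (evenPart t) x (oddPart t))

term-digit-off : ∀ {c} → Admissible c → ∀ {a} t → a ≢ 2 ^ evenPart t → bit (c a * a) t ≡ 0
term-digit-off {c} adm {a} t ne with c a ≟ 0
... | yes ca≡0 rewrite ca≡0 = bit-zero t
... | no ca≢0 with adm a ca≢0
...   | (e , Ee , refl) , _ =
  shifted-digit-off t (coeff-digits adm a) Ee (λ eq → ne (cong (2 ^_) (sym eq)))

partial-sum-digits : ∀ {c} → Admissible c → ∀ B t →
  (2 ^ evenPart t < B → bit (termSum c B) t ≡ bit (c (2 ^ evenPart t)) (oddPart t)) ×
  (B ≤ 2 ^ evenPart t → bit (termSum c B) t ≡ 0)
partial-sum-digits adm zero    t = (λ ()) , (λ _ → bit-zero t)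
partial-sum-digits {c} adm (suc B) t = below , above
  where
    disjoint : DigitDisjoint (termSum c B) (c B * B)
    disjoint s with B ≟ 2 ^ evenPart s
    ... | yes B≡ = inj₁ (proj₂ (partial-sum-digits adm B s) (≤-reflexive B≡))
    ... | no B≢  = inj₂ (term-digit-off adm s B≢)
    split : bit (termSum c (suc B)) t ≡ bit (termSum c B) t + bit (c B * B) t
    split = bit-+ disjoint t
    below : 2 ^ evenPart t < suc B → bit (termSum c (suc B)) t ≡ bit (c (2 ^ evenPart t)) (oddPart t)
    below lt with m<1+n⇒m<n∨m≡n lt
    ... | inj₁ lt′ rewrite split | proj₁ (partial-sum-digits adm B t) lt′
                         | term-digit-off adm t (<⇒≢ lt′ ∘ sym) = +-identityʳ _
    ... | inj₂ eq rewrite split | proj₂ (partial-sum-digits adm B t) (≤-reflexive (sym eq)) =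
      subst (λ b → bit (c b * b) t ≡ bit (c (2 ^ evenPart t)) (oddPart t)) eq
            (shifted-digit-on (c (2 ^ evenPart t)) t)
    above : suc B ≤ 2 ^ evenPart t → bit (termSum c (suc B)) t ≡ 0
    above le rewrite split | proj₂ (partial-sum-digits adm B t) (<⇒≤ le)
                   | term-digit-off adm t (<⇒≢ le) = refl

digit-formula : ∀ {c B} → Admissible c → (∀ a → B ≤ a → c a ≡ 0) →
                ∀ t → bit (termSum c B) t ≡ bit (c (2 ^ evenPart t)) (oddPart t)
digit-formula {c} {B} adm support t with 2 ^ evenPart t <? B
... | yes lt = proj₁ (partial-sum-digits adm B t) lt
... | no ≮  = begin
  bit (termSum c B) t                      ≡⟨ proj₂ (partial-sum-digits adm B t) (≮⇒≥ ≮) ⟩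
  0                                        ≡⟨ bit-zero (oddPart t) ⟨
  bit 0 (oddPart t)                        ≡⟨ cong (λ z → bit z (oddPart t)) (support _ (≮⇒≥ ≮)) ⟨
  bit (c (2 ^ evenPart t)) (oddPart t)     ∎
  where open ≡-Reasoning

-- The canonical representation

2^-injective : ∀ {e e′} → 2 ^ e ≡ 2 ^ e′ → e ≡ e′
2^-injective {e} {e′} eq =
  trans (sym (⌊log₂[2^n]⌋≡n e)) (trans (cong ⌊log₂_⌋ eq) (⌊log₂[2^n]⌋≡n e′))

A? : Decidable A
A? a with DigitsIn? evenPos? ⌊log₂ a ⌋ | a ≟ 2 ^ ⌊log₂ a ⌋
... | yes Ee | yes a≡ = yes (⌊log₂ a ⌋ , Ee , a≡)
... | no ¬Ee | _      = no λ { (e , Ee , refl) → ¬Ee (subst EvenDigits (sym (⌊log₂[2^n]⌋≡n e)) Ee) }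
... | yes _  | no a≢  = no λ { (e , _ , refl) → a≢ (cong (2 ^_) (sym (⌊log₂[2^n]⌋≡n e))) }

block : ℕ → ℕ → ℕ
block n e = keep oddDigits? (shiftDown n e)

block-digit : ∀ n e {f} → OddDigits f → bit (block n e) f ≡ bit n (e + f)
block-digit n e {f} Ff = trans (bit-keep-in oddDigits? (shiftDown n e) Ff) (bit-shiftDown e n f)

canonical : ℕ → ℕ → ℕ
canonical n a with A? a
... | yes (e , _) = block n e
... | no _        = 0

canonical-at : ∀ n {e} → EvenDigits e → canonical n (2 ^ e) ≡ block n e
canonical-at n {e} Ee with A? (2 ^ e)
... | yes (e′ , _ , eq) = cong (block n) (2^-injective {e′} {e} (sym eq))
... | no ¬A             = ⊥-elim (¬A (e , Ee , refl))

canonical-admissible : ∀ n → Admissible (canonical n)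
canonical-admissible n a c≢0 with A? a
... | yes Aa@(e , _) = Aa , n≢0⇒n>0 c≢0 , keep-DigitsIn oddDigits? (shiftDown n e)
... | no _           = ⊥-elim (c≢0 refl)

canonical-support : ∀ n a → 2 ^ n ≤ a → canonical n a ≡ 0
canonical-support n a le with A? a
... | yes (e , _ , refl) = cong (keep oddDigits?) (shiftDown-small e (<-≤-trans (n<2^n n) le))
... | no _               = refl

canonical-sum : ∀ n → termSum (canonical n) (2 ^ n) ≡ n
canonical-sum n = bit-ext λ t → begin
  bit (termSum (canonical n) (2 ^ n)) t               ≡⟨ digit-formula (canonical-admissible n) (canonical-support n) t ⟩
  bit (canonical n (2 ^ evenPart t)) (oddPart t)      ≡⟨ cong (λ z → bit z (oddPart t)) (canonical-at n (evenPart-digits t)) ⟩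
  bit (block n (evenPart t)) (oddPart t)              ≡⟨ block-digit n (evenPart t) (oddPart-digits t) ⟩
  bit n (evenPart t + oddPart t)                      ≡⟨ cong (bit n) (evenPart+oddPart t) ⟩
  bit n t                                             ∎
  where open ≡-Reasoning

canonical-representation : ∀ n → Representation n A M
canonical-representation n = record
  { coeff    = canonical n
  ; coeff-ok = canonical-admissible n
  ; bound    = 2 ^ n
  ; support  = canonical-support n
  ; sums-to  = canonical-sum n
  }

-- Uniqueness

representation-unique : ∀ n (r : Representation n A M) a → coeff r a ≡ canonical n a
representation-unique n r a with A? a
... | yes (e , Ee , refl) = bit-ext digit
  where
    c : ℕ → ℕ
    c = coeff r
    digit : ∀ f → bit (c (2 ^ e)) f ≡ bit (block n e) f
    digit f with oddDigits? f
    ... | no ¬Ff = trans (coeff-digits (coeff-ok r) (2 ^ e) f ¬Ff)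
                         (sym (bit-keep-out oddDigits? (shiftDown n e) ¬Ff))
    ... | yes Ff = begin
      bit (c (2 ^ e)) f                                       ≡⟨ cong₂ (λ u v → bit (c (2 ^ u)) v) ev≡ od≡ ⟨
      bit (c (2 ^ evenPart (e + f))) (oddPart (e + f))        ≡⟨ digit-formula (coeff-ok r) (support r) (e + f) ⟨
      bit (termSum c (bound r)) (e + f)                       ≡⟨ cong (λ z → bit z (e + f)) (sums-to r) ⟩
      bit n (e + f)                                           ≡⟨ block-digit n e Ff ⟨
      bit (block n e) f                                       ∎
      where
        open ≡-Reasoning
        ev≡ : evenPart (e + f) ≡ e
        ev≡ = proj₁ (split-unique Ee Ff)
        od≡ : oddPart (e + f) ≡ f
        od≡ = proj₂ (split-unique Ee Ff)
... | no ¬A with coeff r a ≟ 0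
...   | yes ca≡0 = ca≡0
...   | no ca≢0  = ⊥-elim (¬A (proj₁ (coeff-ok r a ca≢0)))

-- A and M are infinite sets of positive integers

-- Members of A and M as large as desired are 2^(2^p) with p even, resp. odd.
n≤2^n : ∀ n → n ≤ 2 ^ n
n≤2^n n = <⇒≤ (n<2^n n)

2^-digits : ∀ {P : Pred ℕ 0ℓ} p → P p → DigitsIn P (2 ^ p)
2^-digits {P} p Pp s ¬Ps = bit-2^ p (λ s≡p → ¬Ps (subst P (sym s≡p) Pp))

tower-large : ∀ {k p} → k ≤ p → k ≤ 2 ^ 2 ^ p
tower-large {p = p} k≤p = ≤-trans k≤p (≤-trans (n≤2^n p) (n≤2^n (2 ^ p)))

even-k+k : ∀ k → EvenPos (k + k)
even-k+k k = trans (Parity.+-homo-+ k k) (Parity.p+p≡0ℙ (parity k))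

odd-1+k+k : ∀ k → ¬ EvenPos (suc (k + k))
odd-1+k+k k even = Parity.p≢p⁻¹ 1ℙ (trans (sym parity≡1ℙ) even)
  where
    parity≡1ℙ : parity (suc (k + k)) ≡ 1ℙ
    parity≡1ℙ = trans (Parity.+-homo-+ 1 (k + k)) (cong (1ℙ +ℙ_) (even-k+k k))

A-positive : Positive A
A-positive _ (e , _ , refl) = m^n>0 2 e

A-infinite : Infinite A
A-infinite k = 2 ^ 2 ^ (k + k) , tower-large (m≤m+n k k) ,
               2 ^ (k + k) , 2^-digits (k + k) (even-k+k k) , refl

M-positive : Positive M
M-positive _ = proj₁

M-infinite : Infinite M
M-infinite k = 2 ^ 2 ^ suc (k + k) , tower-large (≤-trans (m≤m+n k k) (n≤1+n _)) ,
               m^n>0 2 (2 ^ suc (k + k)) ,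
               2^-digits (2 ^ suc (k + k)) (2^-digits (suc (k + k)) (odd-1+k+k k))

theorem1p1 : Σ NSet λ A → Σ NSet λ M →
    (Positive A × Infinite A) × (Positive M × Infinite M) ×
    (∀ n → 1 ≤ n → HasUniqueRepresentation n A M)
theorem1p1 = A , M , (A-positive , A-infinite) , (M-positive , M-infinite) ,
  λ n _ → canonical-representation n , representation-unique n
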